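{- Let $G$ be a connected graph and let $x$ be a simplicial vertex of $G$. Then $$\mathrm{gp}_{\rm o}(G-x)\le \mathrm{gp}_{\rm o}(G)+\deg_G(x)-1,$$ and this bound is sharp, i.e., equality holds for some such $G$ and $x$.
   Context: All graphs are finite, simple and connected. For a graph $G$ and $Z\subseteq V(G)$, two vertices $p,q\in V(G)$ are $Z$-positionable if no shortest $p,q$-path in $G$ has an internal vertex in $Z$. $Z$ is an outer general position set if every two vertices of $Z$ are $Z$-positionable and every $p\in Z$, $q\in V(G)\setminus Z$ are $Z$-positionable. $\mathrm{gp}_{\rm o}(G)$ is the maximum cardinality of an outer general position set of $G$. A vertex is simplicial if its neighbourhood induces a complete graph. $G-x$ is the graph obtained by deleting $x$ and its incident edges. -}

module Defs where

open import Data.Nat using (ℕ; zero; suc; _<_; _≤_)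
open import Data.Fin using (Fin; punchIn)
open import Data.Fin.Subset using (Subset; _∈_; _∉_; ∣_∣)
open import Data.Bool using (Bool; true; false)
open import Data.Vec using (tabulate)
open import Data.Product using (Σ; ∃; _×_)
open import Relation.Binary.PropositionalEquality using (_≡_; _≢_)
open import Relation.Nullary using (¬_)

record Graph (n : ℕ) : Set where
  field
    adj     : Fin n → Fin n → Bool
    adj-sym : ∀ u v → adj u v ≡ adj v u
    adj-irr : ∀ v → adj v v ≡ false
open Graph public

Adjacent : ∀ {n} → Graph n → Fin n → Fin n → Set
Adjacent G u v = adj G u v ≡ true

-- A walk of length k from p to q: vertices w 0, …, w k (values of w
-- beyond k are irrelevant), consecutive ones adjacent.
Walk : ∀ {n} → Graph n → Fin n → Fin n → ℕ → (ℕ → Fin n) → Set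
Walk G p q k w = (w 0 ≡ p) × (w k ≡ q) × (∀ i → i < k → Adjacent G (w i) (w (suc i)))

-- A shortest p,q-path of length k: a walk of length k such that no
-- p,q-walk is shorter (such a walk is necessarily a path).
ShortestPath : ∀ {n} → Graph n → Fin n → Fin n → ℕ → (ℕ → Fin n) → Set
ShortestPath G p q k w =
  Walk G p q k w × (∀ j → j < k → ∀ w' → ¬ Walk G p q j w')

Connected : ∀ {n} → Graph n → Set
Connected G = ∀ p q → ∃ λ k → ∃ λ w → Walk G p q k w

Positionable : ∀ {n} → Graph n → Subset n → Fin n → Fin n → Set
Positionable G Z p q =
  ∀ k w → ShortestPath G p q k w → ∀ i → 0 < i → i < k → w i ∉ Z

OuterGP : ∀ {n} → Graph n → Subset n → Set
OuterGP G Z =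
  (∀ p q → p ∈ Z → q ∈ Z → Positionable G Z p q) ×
  (∀ p q → p ∈ Z → q ∉ Z → Positionable G Z p q)

IsGpo : ∀ {n} → Graph n → ℕ → Set
IsGpo G k =
  (Σ (Subset _) λ Z → OuterGP G Z × ∣ Z ∣ ≡ k) ×
  (∀ Z → OuterGP G Z → ∣ Z ∣ ≤ k)

neighbourhood : ∀ {n} → Graph n → Fin n → Subset n
neighbourhood G x = tabulate (adj G x)

deg : ∀ {n} → Graph n → Fin n → ℕ
deg G x = ∣ neighbourhood G x ∣

Simplicial : ∀ {n} → Graph n → Fin n → Set
Simplicial G x =
  ∀ y z → Adjacent G x y → Adjacent G x z → y ≢ z → Adjacent G y z

-- G - x : vertices Fin m, embedded into Fin (suc m) by punchIn x
-- (skipping x), with the induced adjacency.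
delete : ∀ {m} → Graph (suc m) → Fin (suc m) → Graph m
delete G x = record
  { adj     = λ u v → adj G (punchIn x u) (punchIn x v)
  ; adj-sym = λ u v → adj-sym G (punchIn x u) (punchIn x v)
  ; adj-irr = λ v → adj-irr G (punchIn x v)
  }

{-# OPTIONS --safe #-}
module Submission where

-- A simplicial vertex x never lies inside a shortest path (its two neighbours on
-- the path are adjacent or equal, which would give a shortcut), so the shortest
-- paths of G joining vertices other than x are exactly those of G - x.  Given an
-- outer general position set S of G - x, delete the neighbours of x from it and,
-- if all of them were in S, add x.  This is an outer general position set of G:
-- a shortest path leaving x first steps to a neighbour, which is not in the set,
-- and then continues as a shortest path of G - x.  Either a neighbour outside S
-- or the new vertex x pays for one of the deg x deleted vertices, so the new set
-- has at least |S| + 1 - deg x elements.  Equality holds for the path P₃ with x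
-- an end vertex.

open import Defs
open import Data.Bool using (Bool; true; false; _∨_)
open import Data.Bool.Properties using (∨-comm)
open import Data.Fin using (Fin; zero; suc; punchIn; punchOut)
open import Data.Fin.Patterns using (0F; 1F; 2F)
open import Data.Fin.Properties using (_≟_; any?; punchIn-injective; punchInᵢ≢i; punchIn-punchOut)
open import Data.Fin.Subset
  using (Subset; _∈_; _∉_; _⊆_; _∪_; _─_; ∣_∣; ⊤; inside; outside)
open import Data.Fin.Subset.Properties
  using (_∈?_; ∈⊤; p⊆p∪q; x∈p∪q⁺; p─q⊆p; p⊂q⇒∣p∣<∣q∣; ∣p∣≤∣p∪q∣; ∣p∣≤n; ∣p∣≡n⇒p≡⊤)
open import Data.Nat using (ℕ; zero; suc; _+_; _∸_; _≤_; _<_; _≤?_; z≤n; s≤s; z<s)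
open import Data.Nat.Properties
  using ( ≤-refl; ≤-trans; <⇒≤; <-irrefl; ≤-<-trans; <-≤-trans; ≮⇒≥; <⇒≱; ≤-pred
        ; m≤n⇒m<n∨m≡n; +-comm; +-assoc; +-suc; +-identityʳ; +-monoˡ-≤; +-monoˡ-<; +-monoʳ-<
        ; +-cancelˡ-≤; n<1+n; m≤m+n; n∸n≡0; m∸n≤m; ∸-monoʳ-<; m<n⇒0<n∸m; m∸[m∸n]≡n
        ; +-∸-assoc; m+[n∸m]≡n; module ≤-Reasoning)
open import Data.Product using (_×_; _,_; proj₁; proj₂; ∃)
open import Data.Sum using (inj₁; inj₂)
open import Data.Vec using (_∷_; []; here; there; tabulate; insertAt)
open import Data.Vec.Properties
  using ([]=⇒lookup; lookup⇒[]=; lookup∘tabulate; insertAt-lookup; insertAt-punchIn)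
open import Function using (_∘_)
open import Relation.Binary.PropositionalEquality
open import Relation.Nullary using (¬_; yes; no; ¬?; contradiction)
open import Relation.Nullary.Decidable using (_×-dec_; decidable-stable)

data PunchInView {n} (i : Fin (suc n)) : Fin (suc n) → Set where
  at      : PunchInView i i
  punched : ∀ j → PunchInView i (punchIn i j)

punchInView : ∀ {n} (i j : Fin (suc n)) → PunchInView i j
punchInView i j with i ≟ j
... | yes refl = at
... | no  i≢j  = subst (PunchInView i) (punchIn-punchOut i≢j) (punched (punchOut i≢j))

tabulate-punchIn : ∀ {n} {A : Set} (f : Fin (suc n) → A) i →
                   tabulate f ≡ insertAt (tabulate (f ∘ punchIn i)) i (f i)
tabulate-punchIn             f zero    = refl
tabulate-punchIn {n = suc n} f (suc i) = cong (f zero ∷_) (tabulate-punchIn (f ∘ suc) i)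

∈-tabulate⁺ : ∀ {n} {f : Fin n → Bool} {i} → f i ≡ true → i ∈ tabulate f
∈-tabulate⁺ {f = f} {i} fi≡true =
  lookup⇒[]= i (tabulate f) (trans (lookup∘tabulate f i) fi≡true)

∈-insertAt-punchIn⁻ : ∀ {n} {p : Subset n} {i j b} → punchIn i j ∈ insertAt p i b → j ∈ p
∈-insertAt-punchIn⁻ {p = p} {i} {j} {b} h =
  lookup⇒[]= j p (trans (sym (insertAt-punchIn p i b j)) ([]=⇒lookup h))

∈-insertAt-self⁻ : ∀ {n} {p : Subset n} {i b} → i ∈ insertAt p i b → b ≡ inside
∈-insertAt-self⁻ {p = p} {i} {b} h = trans (sym (insertAt-lookup p i b)) ([]=⇒lookup h)

∣insertAt∣ : ∀ {n} (p : Subset n) i b → ∣ insertAt p i b ∣ ≡ ∣ b ∷ p ∣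
∣insertAt∣ p              zero    b       = refl
∣insertAt∣ (outside ∷ p) (suc i) b       = ∣insertAt∣ p i b
∣insertAt∣ (inside  ∷ p) (suc i) inside  = cong suc (∣insertAt∣ p i inside)
∣insertAt∣ (inside  ∷ p) (suc i) outside = cong suc (∣insertAt∣ p i outside)

x∈p─q⇒x∉q : ∀ {n} {x : Fin n} {p q : Subset n} → x ∈ p ─ q → x ∉ q
x∈p─q⇒x∉q {p = inside ∷ _} {outside ∷ _} here ()
x∈p─q⇒x∉q {p = _ ∷ _}      {_ ∷ _}      (there x∈p─q) (there x∈q) = x∈p─q⇒x∉q x∈p─q x∈q

∣p∪q∣≡∣p─q∣+∣q∣ : ∀ {n} (p q : Subset n) → ∣ p ∪ q ∣ ≡ ∣ p ─ q ∣ + ∣ q ∣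
∣p∪q∣≡∣p─q∣+∣q∣ []            []            = refl
∣p∪q∣≡∣p─q∣+∣q∣ (inside  ∷ p) (inside  ∷ q) =
  trans (cong suc (∣p∪q∣≡∣p─q∣+∣q∣ p q)) (sym (+-suc _ _))
∣p∪q∣≡∣p─q∣+∣q∣ (inside  ∷ p) (outside ∷ q) = cong suc (∣p∪q∣≡∣p─q∣+∣q∣ p q)
∣p∪q∣≡∣p─q∣+∣q∣ (outside ∷ p) (inside  ∷ q) =
  trans (cong suc (∣p∪q∣≡∣p─q∣+∣q∣ p q)) (sym (+-suc _ _))
∣p∪q∣≡∣p─q∣+∣q∣ (outside ∷ p) (outside ∷ q) = ∣p∪q∣≡∣p─q∣+∣q∣ p q

infixr 5 _◅_

_◅_ : ∀ {A : Set} → A → (ℕ → A) → ℕ → A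
(v ◅ w) zero    = v
(v ◅ w) (suc i) = w i

append : ∀ {A : Set} → (ℕ → A) → ℕ → (ℕ → A) → ℕ → A
append w zero    w′ = w′
append w (suc a) w′ = w 0 ◅ append (w ∘ suc) a w′

module _ {n} (G : Graph n) where

  adjacent-sym : ∀ {u v} → Adjacent G u v → Adjacent G v u
  adjacent-sym {u} {v} u~v = trans (adj-sym G v u) u~v

  walk-refl : ∀ p → Walk G p p 0 (λ _ → p)
  walk-refl p = refl , refl , λ _ ()

  walk-◅ : ∀ {v p q k w} → Adjacent G v p → Walk G p q k w → Walk G v q (suc k) (v ◅ w)
  walk-◅ {v} v~p (w0 , wk , steps) = refl , wk , λ where
    zero    _         → subst (Adjacent G v) (sym w0) v~p
    (suc i) (s≤s i<k) → steps i i<k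

  walk-edge : ∀ p q → Adjacent G p q → Walk G p q 1 (p ◅ λ _ → q)
  walk-edge _ q p~q = walk-◅ p~q (walk-refl q)

  walk-firstStep : ∀ {p q k w} → Walk G p q (suc k) w → Adjacent G p (w 1)
  walk-firstStep {w = w} (w0 , _ , steps) = subst (λ u → Adjacent G u (w 1)) w0 (steps 0 z<s)

  walk-tail : ∀ {p q k w} → Walk G p q (suc k) w → Walk G (w 1) q k (w ∘ suc)
  walk-tail (_ , wk , steps) = refl , wk , λ i i<k → steps (suc i) (s≤s i<k)

  walk-append : ∀ {p r q a c w w′} → Walk G p r a w → Walk G r q c w′ →
                Walk G p q (a + c) (append w a w′)
  walk-append {q = q} {a = zero} {c} {w′ = w′} (w0 , wa , _) W′ =
    subst (λ s → Walk G s q c w′) (trans (sym wa) w0) W′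
  walk-append {q = q} {a = suc a} {c} {w} {w′} W@(w0 , _ , steps) W′ =
    subst (λ s → Walk G s q (suc a + c) (append w (suc a) w′)) w0
          (walk-◅ (steps 0 z<s) (walk-append (walk-tail W) W′))

  walk-take : ∀ {p q k w} a → a ≤ k → Walk G p q k w → Walk G p (w a) a w
  walk-take a a≤k (w0 , _ , steps) = w0 , refl , λ i i<a → steps i (<-≤-trans i<a a≤k)

  walk-drop : ∀ {p q k w} a → a ≤ k → Walk G p q k w →
              Walk G (w a) q (k ∸ a) (λ t → w (a + t))
  walk-drop {k = k} {w} a a≤k (_ , wk , steps) =
    cong w (+-identityʳ a) ,
    trans (cong w (m+[n∸m]≡n a≤k)) wk ,
    λ i i<k∸a → subst (λ j → Adjacent G (w (a + i)) (w j)) (sym (+-suc a i))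
                      (steps (a + i) (subst (a + i <_) (m+[n∸m]≡n a≤k) (+-monoʳ-< a i<k∸a)))

  walk-reverse : ∀ {p q k w} → Walk G p q k w → Walk G q p k (λ i → w (k ∸ i))
  walk-reverse {k = k} {w} (w0 , wk , steps) = wk , trans (cong w (n∸n≡0 k)) w0 , back
    where
    back : ∀ i → i < k → Adjacent G (w (k ∸ i)) (w (k ∸ suc i))
    back i (s≤s {n = k′} i≤k′) =
      subst (λ j → Adjacent G (w j) (w (k′ ∸ i))) (sym (+-∸-assoc 1 i≤k′))
            (adjacent-sym (steps (k′ ∸ i) (s≤s (m∸n≤m k′ i))))

  connected-viaRoot : ∀ r → (∀ p → ∃ λ k → ∃ λ w → Walk G p r k w) → Connected G
  connected-viaRoot r reach p q with reach p | reach q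
  ... | k , w , W | l , v , V = k + l , _ , walk-append W (walk-reverse V)

  shortestPath-≤ : ∀ {p q k w j v} → ShortestPath G p q k w → Walk G p q j v → k ≤ j
  shortestPath-≤ (_ , minimal) V = ≮⇒≥ λ j<k → minimal _ j<k _ V

  shortestPath-segment : ∀ {p q k w a b c v} → ShortestPath G p q k w → b ≤ k →
                         Walk G (w a) (w b) c v → b ≤ a + c
  shortestPath-segment {k = k} {a = a} {b} {c} P@(W , _) b≤k V = ≮⇒≥ λ a+c<b →
    <⇒≱ (shorter a+c<b)
        (shortestPath-≤ P (walk-append (walk-take a (a≤k a+c<b) W)
                                       (walk-append V (walk-drop b b≤k W))))
    where
    open ≤-Reasoning
    a≤k : a + c < b → a ≤ k
    a≤k a+c<b = ≤-trans (m≤m+n a c) (≤-trans (<⇒≤ a+c<b) b≤k)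
    shorter : a + c < b → a + (c + (k ∸ b)) < k
    shorter a+c<b = begin-strict
      a + (c + (k ∸ b)) ≡⟨ +-assoc a c (k ∸ b) ⟨
      a + c + (k ∸ b)   <⟨ +-monoˡ-< (k ∸ b) a+c<b ⟩
      b + (k ∸ b)       ≡⟨ m+[n∸m]≡n b≤k ⟩
      k                 ∎

  shortestPath-tail : ∀ {p q k w} → ShortestPath G p q (suc k) w →
                      ShortestPath G (w 1) q k (w ∘ suc)
  shortestPath-tail {q = q} {k} {w} P@(W@(_ , wk , _) , _) =
    walk-tail W ,
    λ j j<k v V → <⇒≱ j<k (≤-pred (shortestPath-segment P ≤-refl
                                     (subst (λ r → Walk G (w 1) r j v) (sym wk) V)))

  shortestPath-reverse : ∀ {p q k w} → ShortestPath G p q k w →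
                         ShortestPath G q p k (λ i → w (k ∸ i))
  shortestPath-reverse (W , minimal) =
    walk-reverse W , λ j j<k _ V → minimal j j<k _ (walk-reverse V)

  shortestPath-gap : ∀ {p q k w i c v} → ShortestPath G p q k w → suc (suc i) ≤ k →
                     Walk G (w i) (w (suc (suc i))) c v → 2 ≤ c
  shortestPath-gap {i = i} {c} P i+2≤k V =
    +-cancelˡ-≤ i 2 c (subst (_≤ i + c) (+-comm 2 i) (shortestPath-segment P i+2≤k V))

  simplicial⇒¬internal : ∀ {x p q k w i} → Simplicial G x → ShortestPath G p q k w →
                         0 < i → i < k → w i ≢ x
  simplicial⇒¬internal {x} {w = w} {suc i} simplicial P@((_ , _ , steps) , _) _ i+1<k wi+1≡x
    with w i ≟ w (suc (suc i))
  ... | yes equal = contradiction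
    (shortestPath-gap P i+1<k (subst (λ r → Walk G (w i) r 0 (λ _ → w i)) equal (walk-refl (w i))))
    λ ()
  ... | no distinct = contradiction
    (shortestPath-gap P i+1<k (walk-edge _ _ (simplicial _ _ x~before x~after distinct)))
    λ { (s≤s ()) }
    where
    x~before : Adjacent G x (w i)
    x~before = subst (λ u → Adjacent G u (w i)) wi+1≡x
                     (adjacent-sym (steps i (<-≤-trans (n<1+n i) (<⇒≤ i+1<k))))
    x~after : Adjacent G x (w (suc (suc i)))
    x~after = subst (λ u → Adjacent G u (w (suc (suc i)))) wi+1≡x (steps (suc i) i+1<k)

  positionable-short : ∀ {Z p q j v} → Walk G p q j v → j ≤ 1 → Positionable G Z p q
  positionable-short V j≤1 _ _ P i 0<i i<k _ =
    <-irrefl refl (≤-<-trans 0<i (<-≤-trans i<k (≤-trans (shortestPath-≤ P V) j≤1)))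

  positionable-refl : ∀ {Z} p → Positionable G Z p p
  positionable-refl p = positionable-short (walk-refl p) z≤n

  positionable-adjacent : ∀ {Z p q} → Adjacent G p q → Positionable G Z p q
  positionable-adjacent p~q = positionable-short (walk-edge _ _ p~q) ≤-refl

  positionable-sym : ∀ {Z p q} → Positionable G Z p q → Positionable G Z q p
  positionable-sym {Z} pos k w P i 0<i i<k wi∈Z =
    pos k _ (shortestPath-reverse P) (k ∸ i) (m<n⇒0<n∸m i<k) (∸-monoʳ-< 0<i (<⇒≤ i<k))
        (subst (_∈ Z) (sym (cong w (m∸[m∸n]≡n (<⇒≤ i<k)))) wi∈Z)

  positionable-viaNeighbours : ∀ {Z p q} →
    (∀ y → Adjacent G p y → y ∉ Z × Positionable G Z y q) → Positionable G Z p q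
  positionable-viaNeighbours h (suc k) w P 1 _ _ w1∈Z =
    proj₁ (h (w 1) (walk-firstStep (proj₁ P))) w1∈Z
  positionable-viaNeighbours h (suc k) w P (suc (suc i)) _ (s≤s i+1<k) =
    proj₂ (h (w 1) (walk-firstStep (proj₁ P))) k (w ∘ suc) (shortestPath-tail P) (suc i) z<s i+1<k

  positionable⇒outerGP : ∀ {Z} → (∀ p q → p ∈ Z → Positionable G Z p q) → OuterGP G Z
  positionable⇒outerGP h = (λ p q p∈Z _ → h p q p∈Z) , (λ p q p∈Z _ → h p q p∈Z)

  outerGP⇒positionable : ∀ {Z p} → OuterGP G Z → ∀ q → p ∈ Z → Positionable G Z p q
  outerGP⇒positionable {Z} {p} (inner , outer) q p∈Z with q ∈? Z
  ... | yes q∈Z = inner p q p∈Z q∈Z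
  ... | no  q∉Z = outer p q p∈Z q∉Z

module _ {m} (G : Graph (suc m)) (x : Fin (suc m)) where

  walk-punchIn : ∀ {p q k w} → Walk (delete G x) p q k w →
                 Walk G (punchIn x p) (punchIn x q) k (punchIn x ∘ w)
  walk-punchIn (w0 , wk , steps) = cong (punchIn x) w0 , cong (punchIn x) wk , steps

  shortestPath-delete : ∀ {p q k w} → ShortestPath G (punchIn x p) (punchIn x q) k w →
    (∀ i → i ≤ k → w i ≢ x) →
    ∃ λ w′ → ShortestPath (delete G x) p q k w′ × (∀ i → i ≤ k → punchIn x (w′ i) ≡ w i)
  shortestPath-delete {p} {q} {k} {w} ((w0 , wk , steps) , minimal) avoids =
    w′ , (W′ , λ j j<k v V → minimal j j<k _ (walk-punchIn V)) , section
    where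
    w′ : ℕ → Fin m
    w′ i with i ≤? k
    ... | yes i≤k = punchOut (avoids i i≤k ∘ sym)
    ... | no  _   = p
    section : ∀ i → i ≤ k → punchIn x (w′ i) ≡ w i
    section i i≤k with i ≤? k
    ... | yes _   = punchIn-punchOut _
    ... | no  i≰k = contradiction i≤k i≰k
    W′ : Walk (delete G x) p q k w′
    W′ = punchIn-injective x _ _ (trans (section 0 z≤n) w0) ,
         punchIn-injective x _ _ (trans (section k ≤-refl) wk) ,
         λ i i<k → subst₂ (Adjacent G) (sym (section i (<⇒≤ i<k))) (sym (section (suc i) i<k))
                                        (steps i i<k)

  simplicial⇒avoids : ∀ {p q k w} → Simplicial G x →
                      ShortestPath G (punchIn x p) (punchIn x q) k w → ∀ i → i ≤ k → w i ≢ x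
  simplicial⇒avoids {p} _ ((w0 , _ , _) , _) zero _ w0≡x = punchInᵢ≢i x p (trans (sym w0) w0≡x)
  simplicial⇒avoids {q = q} simplicial P@((_ , wk , _) , _) (suc i) i+1≤k wi+1≡x
    with m≤n⇒m<n∨m≡n i+1≤k
  ... | inj₁ i+1<k = simplicial⇒¬internal G simplicial P z<s i+1<k wi+1≡x
  ... | inj₂ refl  = punchInᵢ≢i x q (trans (sym wk) wi+1≡x)

  positionable-delete : ∀ {Z S p q} → Simplicial G x → (∀ u → punchIn x u ∈ Z → u ∈ S) →
    Positionable (delete G x) S p q → Positionable G Z (punchIn x p) (punchIn x q)
  positionable-delete {Z} simplicial Z⊆S pos k w P i 0<i i<k wi∈Z
    with shortestPath-delete P (simplicial⇒avoids simplicial P)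
  ... | w′ , P′ , section =
    pos k w′ P′ i 0<i i<k (Z⊆S (w′ i) (subst (_∈ Z) (sym (section i (<⇒≤ i<k))) wi∈Z))

module Extension {m} (G : Graph (suc m)) (x : Fin (suc m)) (simplicial : Simplicial G x)
                 {S : Subset m} (S-outerGP : OuterGP (delete G x) S) where

  N⁻ : Subset m
  N⁻ = tabulate (adj G x ∘ punchIn x)

  Z : Bool → Subset (suc m)
  Z b = insertAt (S ─ N⁻) x b

  Z⊆S : ∀ {b} u → punchIn x u ∈ Z b → u ∈ S
  Z⊆S u u∈Z = p─q⊆p S N⁻ (∈-insertAt-punchIn⁻ u∈Z)

  positionable-fromX : ∀ {b q} → (∀ y → y ∈ N⁻ → Positionable G (Z b) (punchIn x y) q) →
                       Positionable G (Z b) x q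
  positionable-fromX {b} {q} h = positionable-viaNeighbours G neighbour
    where
    neighbour : ∀ y → Adjacent G x y → y ∉ Z b × Positionable G (Z b) y q
    neighbour y x~y with punchInView x y
    ... | at         = contradiction (trans (sym (adj-irr G x)) x~y) λ ()
    ... | punched y′ = (λ y∈Z → x∈p─q⇒x∉q (∈-insertAt-punchIn⁻ y∈Z) y′∈N⁻) , h y′ y′∈N⁻
      where
      y′∈N⁻ : y′ ∈ N⁻
      y′∈N⁻ = ∈-tabulate⁺ x~y

  Z-outerGP : ∀ {b} → (b ≡ inside → N⁻ ⊆ S) → OuterGP G (Z b)
  Z-outerGP {b} N⁻⊆S = positionable⇒outerGP G positionable
    where
    lift : ∀ {p q} → Positionable (delete G x) S p q →
           Positionable G (Z b) (punchIn x p) (punchIn x q)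
    lift = positionable-delete G x simplicial Z⊆S
    S-positionable : ∀ {p} q → p ∈ S → Positionable (delete G x) S p q
    S-positionable = outerGP⇒positionable (delete G x) S-outerGP
    positionable : ∀ p q → p ∈ Z b → Positionable G (Z b) p q
    positionable p q p∈Z with punchInView x p | punchInView x q
    ... | at         | at         = positionable-refl G x
    ... | at         | punched q′ = positionable-fromX λ y y∈N⁻ →
      lift (S-positionable q′ (N⁻⊆S (∈-insertAt-self⁻ p∈Z) y∈N⁻))
    ... | punched p′ | at         = positionable-sym G (positionable-fromX λ y _ →
      lift (positionable-sym (delete G x) (S-positionable y (Z⊆S p′ p∈Z))))
    ... | punched p′ | punched q′ = lift (S-positionable q′ (Z⊆S p′ p∈Z))

  ∣Z∣+deg : ∀ b → ∣ Z b ∣ + deg G x ≡ ∣ b ∷ (S ─ N⁻) ∣ + ∣ N⁻ ∣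
  ∣Z∣+deg b = cong₂ _+_ (∣insertAt∣ (S ─ N⁻) x b) deg≡∣N⁻∣
    where
    open ≡-Reasoning
    deg≡∣N⁻∣ : deg G x ≡ ∣ N⁻ ∣
    deg≡∣N⁻∣ = begin
      ∣ tabulate (adj G x) ∣       ≡⟨ cong ∣_∣ (tabulate-punchIn (adj G x) x) ⟩
      ∣ insertAt N⁻ x (adj G x x) ∣ ≡⟨ ∣insertAt∣ N⁻ x (adj G x x) ⟩
      ∣ adj G x x ∷ N⁻ ∣           ≡⟨ cong (λ b → ∣ b ∷ N⁻ ∣) (adj-irr G x) ⟩
      ∣ N⁻ ∣                       ∎

  outerGP-extension : ∃ λ Z′ → OuterGP G Z′ × ∣ S ∣ < ∣ Z′ ∣ + deg G x
  outerGP-extension with any? (λ y → y ∈? N⁻ ×-dec ¬? (y ∈? S))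
  ... | yes (y , y∈N⁻ , y∉S) = Z outside , Z-outerGP (λ ()) , (begin-strict
    ∣ S ∣                 <⟨ p⊂q⇒∣p∣<∣q∣ (p⊆p∪q N⁻ , y , x∈p∪q⁺ (inj₂ y∈N⁻) , y∉S) ⟩
    ∣ S ∪ N⁻ ∣            ≡⟨ ∣p∪q∣≡∣p─q∣+∣q∣ S N⁻ ⟩
    ∣ S ─ N⁻ ∣ + ∣ N⁻ ∣   ≡⟨ ∣Z∣+deg outside ⟨
    ∣ Z outside ∣ + deg G x ∎)
    where open ≤-Reasoning
  ... | no ∄y = Z inside , Z-outerGP N⁻⊆S , (begin-strict
    ∣ S ∣                     ≤⟨ ∣p∣≤∣p∪q∣ S N⁻ ⟩
    ∣ S ∪ N⁻ ∣                ≡⟨ ∣p∪q∣≡∣p─q∣+∣q∣ S N⁻ ⟩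
    ∣ S ─ N⁻ ∣ + ∣ N⁻ ∣       <⟨ n<1+n _ ⟩
    suc (∣ S ─ N⁻ ∣ + ∣ N⁻ ∣) ≡⟨ ∣Z∣+deg inside ⟨
    ∣ Z inside ∣ + deg G x    ∎)
    where
    open ≤-Reasoning
    N⁻⊆S : inside ≡ inside → N⁻ ⊆ S
    N⁻⊆S _ {y} y∈N⁻ = decidable-stable (y ∈? S) λ y∉S → ∄y (y , y∈N⁻ , y∉S)

gpo-delete-simplicial : ∀ {m} (G : Graph (suc m)) x {a b} → Simplicial G x →
                        IsGpo (delete G x) a → IsGpo G b → a < b + deg G x
gpo-delete-simplicial G x simplicial ((S , S-outerGP , refl) , _) (_ , maximal)
  with Extension.outerGP-extension G x simplicial S-outerGP
... | Z , Z-outerGP , ∣S∣<∣Z∣+deg = <-≤-trans ∣S∣<∣Z∣+deg (+-monoˡ-≤ (deg G x) (maximal Z Z-outerGP))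

P₃-arc : Fin 3 → Fin 3 → Bool
P₃-arc 0F 1F = true
P₃-arc 1F 2F = true
P₃-arc _  _  = false

P₃ : Graph 3
P₃ = record
  { adj     = λ u v → P₃-arc u v ∨ P₃-arc v u
  ; adj-sym = λ u v → ∨-comm (P₃-arc u v) (P₃-arc v u)
  ; adj-irr = λ { 0F → refl ; 1F → refl ; 2F → refl }
  }

K₂ : Graph 2
K₂ = delete P₃ 0F

0—1—2 : ShortestPath P₃ 0F 2F 2 (0F ◅ 1F ◅ λ _ → 2F)
0—1—2 = (refl , refl , λ { 0 _ → refl ; 1 _ → refl ; (suc (suc _)) (s≤s (s≤s ())) }) , no-shorter
  where
  no-shorter : ∀ j → j < 2 → ∀ v → ¬ Walk P₃ 0F 2F j v
  no-shorter 0 _ v (v0 , v0′ , _) with trans (sym v0) v0′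
  ... | ()
  no-shorter 1 _ v (v0 , v1 , steps) with subst₂ (Adjacent P₃) v0 v1 (steps 0 z<s)
  ... | ()
  no-shorter (suc (suc _)) (s≤s (s≤s ()))

connected-P₃ : Connected P₃
connected-P₃ = connected-viaRoot P₃ 1F λ where
  0F → 1 , (0F ◅ λ _ → 1F) , walk-edge P₃ 0F 1F refl
  1F → 0 , (λ _ → 1F) , walk-refl P₃ 1F
  2F → 1 , (2F ◅ λ _ → 1F) , walk-edge P₃ 2F 1F refl

simplicial-P₃ : Simplicial P₃ 0F
simplicial-P₃ 1F 1F _  _  1≢1 = contradiction refl 1≢1
simplicial-P₃ 0F _  () _  _
simplicial-P₃ 2F _  () _  _
simplicial-P₃ 1F 0F _  () _
simplicial-P₃ 1F 2F _  () _

¬outerGP-⊤ : ¬ OuterGP P₃ ⊤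
¬outerGP-⊤ (inner , _) = inner 0F 2F ∈⊤ ∈⊤ 2 (0F ◅ 1F ◅ λ _ → 2F) 0—1—2 1 z<s ≤-refl ∈⊤

K₂-outerGP : OuterGP K₂ ⊤
K₂-outerGP = positionable⇒outerGP K₂ positionable
  where
  positionable : ∀ p q → p ∈ ⊤ → Positionable K₂ ⊤ p q
  positionable 0F 0F _ = positionable-refl K₂ 0F
  positionable 0F 1F _ = positionable-adjacent K₂ refl
  positionable 1F 0F _ = positionable-adjacent K₂ refl
  positionable 1F 1F _ = positionable-refl K₂ 1F

gpo-K₂ : IsGpo K₂ 2
gpo-K₂ = (⊤ , K₂-outerGP , refl) , λ Z _ → ∣p∣≤n Z

gpo-P₃ : IsGpo P₃ 2
-- Z inside = {0, 2}, the extension of the whole vertex set of K₂.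
gpo-P₃ = (Z inside , Z-outerGP (λ _ _ → ∈⊤) , refl) , maximal
  where
  open Extension P₃ 0F simplicial-P₃ K₂-outerGP
  maximal : ∀ Y → OuterGP P₃ Y → ∣ Y ∣ ≤ 2
  maximal Y Y-outerGP with m≤n⇒m<n∨m≡n (∣p∣≤n Y)
  ... | inj₁ ∣Y∣<3 = ≤-pred ∣Y∣<3
  ... | inj₂ ∣Y∣≡3 = contradiction (subst (OuterGP P₃) (∣p∣≡n⇒p≡⊤ ∣Y∣≡3) Y-outerGP) ¬outerGP-⊤

proposition3p5 :
    (∀ m (G : Graph (suc (suc m))) (x : Fin (suc (suc m))) →
      Connected G → Simplicial G x →
      ∀ a b → IsGpo (delete G x) a → IsGpo G b →
      a + 1 ≤ b + deg G x)
    ×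
    (∃ λ m → ∃ λ (G : Graph (suc (suc m))) → ∃ λ (x : Fin (suc (suc m))) →
      Connected G × Simplicial G x ×
      ∃ λ a → ∃ λ b → IsGpo (delete G x) a × IsGpo G b ×
      a + 1 ≡ b + deg G x)
proposition3p5 =
  (λ m G x _ simplicial a b gpo-a gpo-b →
     subst (_≤ b + deg G x) (+-comm 1 a) (gpo-delete-simplicial G x simplicial gpo-a gpo-b)) ,
  (1 , P₃ , 0F , connected-P₃ , simplicial-P₃ , 2 , 2 , gpo-K₂ , gpo-P₃ , refl)
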